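{- In $\mathbf{S}$, for all formulas $A,B,C\in\mathsf{Form}_\supset$: (i) $\{A, A\to B\}\vdash B$ (i.e. modus ponens for $\to$ is derivable); and the following are theorems (derivable from the empty set): (ii) $A\supset((A\supset B)\to B)$; (iii) $A\to(B\supset A)$; (iv) $A\supset(B\supset A)$; (v) $(A\supset(B\supset C))\supset((A\supset B)\supset(A\supset C))$; (vi) $A\lor(A\supset B)$.
   Context: Formulas $\mathsf{Form}_\supset$ are built from a countable set of propositional variables using binary connectives $\land,\lor,\to,\supset$. The proof system $\mathbf{S}$ has axiom schemata (for all formulas $A,B,C$) (Ax1) $A\to(B\to A)$; (Ax2) $(A\to(B\to C))\to((A\to B)\to(A\to C))$; (Ax3) $(A\land B)\to A$; (Ax4) $(A\land B)\to B$; (Ax5) $(C\to A)\to((C\to B)\to(C\to(A\land B)))$; (Ax6) $A\to(A\lor B)$; (Ax7) $B\to(A\lor B)$; (Ax8) $(A\to C)\to((B\to C)\to((A\lor B)\to C))$; (AxM1) $(A\to B)\supset(A\supset B)$; (AxM2) $(A\supset(B\supset C))\to((A\supset B)\supset(A\supset C))$; (AxM3) $(A\supset(B\to C))\to(B\to(A\supset C))$; (AxM4) $(A\to(B\supset C))\to(B\supset(A\to C))$; (AxM5) $((A\supset B)\supset C)\to((A\supset C)\to C)$; (AxM6) $(A\supset C)\to((B\supset C)\to((A\lor B)\supset C))$; and the single rule (MP): from $A$ and $A\supset B$ infer $B$. $\Gamma\vdash A$ iff there is a finite sequence ending in $A$ each member of which is in $\Gamma$, an axiom instance, or obtained by (MP)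 from earlier members. -}

module Defs where

open import Data.Nat using (ℕ)
open import Data.Empty using (⊥)
open import Data.Sum using (_⊎_)
open import Relation.Binary.PropositionalEquality using (_≡_)

infixr 5 _→'_ _⊃_
infixr 6 _∨'_
infixr 7 _∧'_

data Form : Set where
  var   : ℕ → Form
  _∧'_  : Form → Form → Form
  _∨'_  : Form → Form → Form
  _→'_  : Form → Form → Form
  _⊃_   : Form → Form → Form

data Axiom : Form → Set where
  ax1  : ∀ A B → Axiom (A →' (B →' A))
  ax2  : ∀ A B C → Axiom ((A →' (B →' C)) →' ((A →' B) →' (A →' C)))
  ax3  : ∀ A B → Axiom ((A ∧' B) →' A)
  ax4  : ∀ A B → Axiom ((A ∧' B) →' B)
  ax5  : ∀ A B C → Axiom ((C →' A) →' ((C →' B) →' (C →' (A ∧' B))))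
  ax6  : ∀ A B → Axiom (A →' (A ∨' B))
  ax7  : ∀ A B → Axiom (B →' (A ∨' B))
  ax8  : ∀ A B C → Axiom ((A →' C) →' ((B →' C) →' ((A ∨' B) →' C)))
  axM1 : ∀ A B → Axiom ((A →' B) ⊃ (A ⊃ B))
  axM2 : ∀ A B C → Axiom ((A ⊃ (B ⊃ C)) →' ((A ⊃ B) ⊃ (A ⊃ C)))
  axM3 : ∀ A B C → Axiom ((A ⊃ (B →' C)) →' (B →' (A ⊃ C)))
  axM4 : ∀ A B C → Axiom ((A →' (B ⊃ C)) →' (B ⊃ (A →' C)))
  axM5 : ∀ A B C → Axiom (((A ⊃ B) ⊃ C) →' ((A ⊃ C) →' C))
  axM6 : ∀ A B C → Axiom ((A ⊃ C) →' ((B ⊃ C) →' ((A ∨' B) ⊃ C)))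

FormSet : Set₁
FormSet = Form → Set

-- Γ ⊢ A : derivability (inductive closure, equivalent to existence of a finite
-- derivation sequence) with the single rule MP for ⊃
infix 3 _⊢_
data _⊢_ (Γ : FormSet) : Form → Set where
  hyp : ∀ {A} → Γ A → Γ ⊢ A
  ax  : ∀ {A} → Axiom A → Γ ⊢ A
  mp  : ∀ {A B} → Γ ⊢ A → Γ ⊢ (A ⊃ B) → Γ ⊢ B

∅ : FormSet
∅ _ = ⊥

⟨_,_⟩ : Form → Form → FormSet
⟨ A , B ⟩ X = (X ≡ A) ⊎ (X ≡ B)

-- AxM1 turns every derivable implication A → B into A ⊃ B, so the primitive
-- rule for ⊃ also gives modus ponens for →. With it, each of (ii)–(vi) is an
-- instance of one of AxM2–AxM5 whose premisses are derived in the
-- Hilbert-style →-fragment (Ax1, Ax2, Ax6, Ax7).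
module Submission where

open import Defs
open import Data.Product using (_×_; _,_)
open import Data.Sum using (inj₁; inj₂)
open import Relation.Binary.PropositionalEquality using (refl)

module _ {Γ : FormSet} where

  →⇒⊃ : ∀ {A B} → Γ ⊢ A →' B → Γ ⊢ A ⊃ B
  →⇒⊃ {A} {B} d = mp d (ax (axM1 A B))

  mp→ : ∀ {A B} → Γ ⊢ A →' B → Γ ⊢ A → Γ ⊢ B
  mp→ d e = mp e (→⇒⊃ d)

  →-refl : ∀ A → Γ ⊢ A →' A
  →-refl A = mp→ (mp→ (ax (ax2 A (A →' A) A)) (ax (ax1 A (A →' A)))) (ax (ax1 A A))

  ⊃-weaken : ∀ {A} B → Γ ⊢ A → Γ ⊢ B ⊃ A
  ⊃-weaken {A} B d = →⇒⊃ (mp→ (ax (ax1 A B)) d)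

  ⊃-modusPonens : ∀ A B → Γ ⊢ A ⊃ ((A ⊃ B) →' B)
  ⊃-modusPonens A B = mp→ (ax (axM4 (A ⊃ B) A B)) (→-refl (A ⊃ B))

  →⊃-const : ∀ A B → Γ ⊢ A →' (B ⊃ A)
  →⊃-const A B = mp→ (ax (axM3 B A A)) (⊃-weaken B (→-refl A))

  ⊃-const : ∀ A B → Γ ⊢ A ⊃ (B ⊃ A)
  ⊃-const A B = →⇒⊃ (→⊃-const A B)

  ⊃-distrib : ∀ A B C → Γ ⊢ (A ⊃ (B ⊃ C)) ⊃ ((A ⊃ B) ⊃ (A ⊃ C))
  ⊃-distrib A B C = →⇒⊃ (ax (axM2 A B C))

  -- AxM5 with C := A ∨ (A ⊃ B): both disjuncts ⊃-imply the disjunction.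
  ⊃-excludedMiddle : ∀ A B → Γ ⊢ A ∨' (A ⊃ B)
  ⊃-excludedMiddle A B =
    mp→ (mp→ (ax (axM5 A B (A ∨' (A ⊃ B)))) (→⇒⊃ (ax (ax7 A (A ⊃ B)))))
        (→⇒⊃ (ax (ax6 A (A ⊃ B))))

mainTheorem5 : (A B C : Form) →
    (⟨ A , A →' B ⟩ ⊢ B)
    × (∅ ⊢ A ⊃ ((A ⊃ B) →' B))
    × (∅ ⊢ A →' (B ⊃ A))
    × (∅ ⊢ A ⊃ (B ⊃ A))
    × (∅ ⊢ (A ⊃ (B ⊃ C)) ⊃ ((A ⊃ B) ⊃ (A ⊃ C)))
    × (∅ ⊢ A ∨' (A ⊃ B))
mainTheorem5 A B C =
    mp→ (hyp (inj₂ refl)) (hyp (inj₁ refl))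
  , ⊃-modusPonens A B
  , →⊃-const A B
  , ⊃-const A B
  , ⊃-distrib A B C
  , ⊃-excludedMiddle A B
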